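{- Let $f$ be an $n$-ary polymorphism of $(\mathbf{LO}_2,\mathbf{LO}_3)$. If $X\subseteq[n]$ is a 2-set of $f$ and $Y$ is a boolean set of $f$ with $X\subseteq Y$, then $Y$ is 2-recolourable.
   Context: $[n]=\{1,\dots,n\}$. $\mathrm{LO}_3\subseteq\{0,1,2\}^3$ is the set of triples whose maximum entry occurs in exactly one coordinate. Identify $X\subseteq[n]$ with the 0/1 tuple having 1 exactly in positions of $X$. $f:\{0,1\}^n\to\{0,1,2\}$ is a polymorphism of $(\mathbf{LO}_2,\mathbf{LO}_3)$ iff for every ordered partition $(X,Y,Z)$ of $[n]$ into three (possibly empty) parts, $(f(X),f(Y),f(Z))\in\mathrm{LO}_3$. $X$ is a 2-set if $f(X)=2$, a boolean set if $f(X)\in\{0,1\}$. $Y$ is 2-recolourable if the function agreeing with $f$ except taking value 2 at $Y$ is still a polymorphism. -}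

module Defs where

open import Data.Nat using (ℕ)
open import Data.Fin using (Fin; zero; suc)
open import Data.Fin.Subset using (Subset; _∈_; _∉_; _⊆_)
open import Data.Vec using (_[_]≔_)
open import Data.Product using (_×_)
open import Relation.Nullary using (¬_)
open import Relation.Binary.PropositionalEquality using (_≡_; _≢_)

D3 : Set
D3 = Fin 3

two : D3
two = suc (suc zero)

-- LO₃: triples over {0,1,2} whose maximum entry occurs in exactly one coordinate.
data LO3 : D3 → D3 → D3 → Set where
  lo-two-a : ∀ {b c} → b ≢ two → c ≢ two → LO3 two b c
  lo-two-b : ∀ {a c} → a ≢ two → c ≢ two → LO3 a two c
  lo-two-c : ∀ {a b} → a ≢ two → b ≢ two → LO3 a b two
  lo-one-a : LO3 (suc zero) zero zero
  lo-one-b : LO3 zero (suc zero) zero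
  lo-one-c : LO3 zero zero (suc zero)

IsPartition3 : ∀ {n} → Subset n → Subset n → Subset n → Set
IsPartition3 {n} X Y Z =
  ∀ (i : Fin n) →
    ((i ∈ X) × (i ∉ Y) × (i ∉ Z))
    Data.Sum.⊎ (((i ∉ X) × (i ∈ Y) × (i ∉ Z))
    Data.Sum.⊎ ((i ∉ X) × (i ∉ Y) × (i ∈ Z)))
  where import Data.Sum

-- f : {0,1}^n → {0,1,2} (subsets of [n] identified with 0/1 tuples)
-- is a polymorphism of (LO₂, LO₃).
IsPolymorphism : ∀ {n} → (Subset n → D3) → Set
IsPolymorphism {n} f =
  ∀ (X Y Z : Subset n) → IsPartition3 X Y Z → LO3 (f X) (f Y) (f Z)

TwoSet : ∀ {n} → (Subset n → D3) → Subset n → Set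
TwoSet f X = f X ≡ two

BooleanSet : ∀ {n} → (Subset n → D3) → Subset n → Set
BooleanSet f X = f X ≢ two

recolour : ∀ {n} → (Subset n → D3) → Subset n → (Subset n → D3)
recolour {n} f Y X with Data.Vec.Properties.≡-dec Data.Bool.Properties._≟_ X Y
  where import Data.Vec.Properties; import Data.Bool.Properties
... | Relation.Nullary.yes _ = two
... | Relation.Nullary.no _ = f X

TwoRecolourable : ∀ {n} → (Subset n → D3) → Subset n → Set
TwoRecolourable f Y = IsPolymorphism (recolour f Y)

-- Two disjoint sets cannot both be 2-sets: completing them to a partition gives a triple with the
-- value 2 twice. So in a partition having Y ⊇ X as a part, every other part is disjoint from X and
-- hence boolean; and no other part equals Y, since then X would be disjoint from itself, i.e. the
-- 2-set ∅ would be disjoint from a 2-set. Hence after recolouring, the 2 at Y is the unique maximum of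
-- every triple containing Y, and all other triples are unchanged.
module Submission where

open import Defs
open import Data.Nat using (ℕ)
open import Data.Fin.Subset using (Subset; _∈_; _∉_; _⊆_; _∪_; ∁)
open import Data.Fin.Subset.Properties using (_∈?_; x∈p∪q⁺; x∈p∪q⁻; x∈p⇒x∉∁p; x∉p⇒x∈∁p)
open import Data.Bool.Properties using (_≟_)
open import Data.Vec.Properties using (≡-dec)
open import Data.Product using (_,_)
open import Data.Sum using (inj₁; inj₂; [_,_])
open import Data.Empty using (⊥-elim)
open import Function using (_∘_)
open import Relation.Nullary using (¬_; Dec; yes; no)
open import Relation.Binary.PropositionalEquality using (_≡_; _≢_; refl; subst)

Disjoint : ∀ {n} → Subset n → Subset n → Set
Disjoint P Q = ∀ {i} → i ∈ P → i ∉ Q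

Disjoint-sym : ∀ {n} {P Q : Subset n} → Disjoint P Q → Disjoint Q P
Disjoint-sym d i∈Q i∈P = d i∈P i∈Q

Disjoint-monoˡ : ∀ {n} {P P′ Q : Subset n} → P′ ⊆ P → Disjoint P Q → Disjoint P′ Q
Disjoint-monoˡ P′⊆P d = d ∘ P′⊆P

Disjoint-monoʳ : ∀ {n} {P Q Q′ : Subset n} → Q′ ⊆ Q → Disjoint P Q → Disjoint P Q′
Disjoint-monoʳ Q′⊆Q d i∈P = d i∈P ∘ Q′⊆Q

disjoint⇒partition : ∀ {n} {P Q : Subset n} → Disjoint P Q → IsPartition3 P Q (∁ (P ∪ Q))
disjoint⇒partition {P = P} {Q} d i with i ∈? P | i ∈? Q
... | yes i∈P | _       = inj₁ (i∈P , d i∈P , x∈p⇒x∉∁p (x∈p∪q⁺ (inj₁ i∈P)))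
... | no i∉P  | yes i∈Q = inj₂ (inj₁ (i∉P , i∈Q , x∈p⇒x∉∁p (x∈p∪q⁺ (inj₂ i∈Q))))
... | no i∉P  | no i∉Q  = inj₂ (inj₂ (i∉P , i∉Q , x∉p⇒x∈∁p ([ i∉P , i∉Q ] ∘ x∈p∪q⁻ P Q)))

module _ {n} {A B C : Subset n} (partition : IsPartition3 A B C) where

  partition-disjoint₁₂ : Disjoint A B
  partition-disjoint₁₂ {i} i∈A i∈B with partition i
  ... | inj₁ (_ , i∉B , _)        = i∉B i∈B
  ... | inj₂ (inj₁ (i∉A , _ , _)) = i∉A i∈A
  ... | inj₂ (inj₂ (i∉A , _ , _)) = i∉A i∈A

  partition-disjoint₁₃ : Disjoint A C
  partition-disjoint₁₃ {i} i∈A i∈C with partition i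
  ... | inj₁ (_ , _ , i∉C)        = i∉C i∈C
  ... | inj₂ (inj₁ (i∉A , _ , _)) = i∉A i∈A
  ... | inj₂ (inj₂ (i∉A , _ , _)) = i∉A i∈A

  partition-disjoint₂₃ : Disjoint B C
  partition-disjoint₂₃ {i} i∈B i∈C with partition i
  ... | inj₁ (_ , i∉B , _)        = i∉B i∈B
  ... | inj₂ (inj₁ (_ , _ , i∉C)) = i∉C i∈C
  ... | inj₂ (inj₂ (_ , i∉B , _)) = i∉B i∈B

LO3-two-unique : ∀ {b c} → LO3 two b c → b ≢ two
LO3-two-unique (lo-two-a b≢2 _) = b≢2
LO3-two-unique (lo-two-b 2≢2 _) = ⊥-elim (2≢2 refl)
LO3-two-unique (lo-two-c 2≢2 _) = ⊥-elim (2≢2 refl)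

recolour-self : ∀ {n} (f : Subset n → D3) (Y : Subset n) → recolour f Y Y ≡ two
recolour-self f Y with ≡-dec _≟_ Y Y
... | yes _   = refl
... | no Y≢Y  = ⊥-elim (Y≢Y refl)

recolour-other : ∀ {n} (f : Subset n → D3) {Y Z : Subset n} → Z ≢ Y → recolour f Y Z ≡ f Z
recolour-other f {Y} {Z} Z≢Y with ≡-dec _≟_ Z Y
... | yes Z≡Y = ⊥-elim (Z≢Y Z≡Y)
... | no _    = refl

module _ {n} {f : Subset n → D3} (polymorphism : IsPolymorphism f) where

  disjoint-twoSet⇒booleanSet : ∀ {X B} → TwoSet f X → Disjoint X B → BooleanSet f B
  disjoint-twoSet⇒booleanSet {X} {B} fX≡2 d =
    LO3-two-unique (subst (λ v → LO3 v (f B) (f (∁ (X ∪ B)))) fX≡2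
                          (polymorphism X B (∁ (X ∪ B)) (disjoint⇒partition d)))

  twoSet-not-self-disjoint : ∀ {X} → TwoSet f X → ¬ Disjoint X X
  twoSet-not-self-disjoint fX≡2 d = disjoint-twoSet⇒booleanSet fX≡2 d fX≡2

  module _ {X Y : Subset n} (fX≡2 : TwoSet f X) (X⊆Y : X ⊆ Y) where

    recolour-disjoint-booleanSet : ∀ {Z} → Disjoint Y Z → BooleanSet (recolour f Y) Z
    recolour-disjoint-booleanSet {Z} d with ≡-dec _≟_ Z Y
    ... | yes refl = ⊥-elim (twoSet-not-self-disjoint fX≡2 (Disjoint-monoʳ X⊆Y (Disjoint-monoˡ X⊆Y d)))
    ... | no _     = disjoint-twoSet⇒booleanSet fX≡2 (Disjoint-monoˡ X⊆Y d)

    -- The decisions are taken as arguments rather than by 'with', which would also abstract them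
    -- inside the 'recolour' terms and break the lemmas about those.
    recolour-partition : ∀ {A B C} → IsPartition3 A B C → Dec (A ≡ Y) → Dec (B ≡ Y) → Dec (C ≡ Y) →
                         LO3 (recolour f Y A) (recolour f Y B) (recolour f Y C)
    recolour-partition P (yes refl) _ _ rewrite recolour-self f Y =
      lo-two-a (recolour-disjoint-booleanSet (partition-disjoint₁₂ P))
               (recolour-disjoint-booleanSet (partition-disjoint₁₃ P))
    recolour-partition P _ (yes refl) _ rewrite recolour-self f Y =
      lo-two-b (recolour-disjoint-booleanSet (Disjoint-sym (partition-disjoint₁₂ P)))
               (recolour-disjoint-booleanSet (partition-disjoint₂₃ P))
    recolour-partition P _ _ (yes refl) rewrite recolour-self f Y =
      lo-two-c (recolour-disjoint-booleanSet (Disjoint-sym (partition-disjoint₁₃ P)))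
               (recolour-disjoint-booleanSet (Disjoint-sym (partition-disjoint₂₃ P)))
    recolour-partition {A} {B} {C} P (no A≢Y) (no B≢Y) (no C≢Y)
      rewrite recolour-other f A≢Y | recolour-other f B≢Y | recolour-other f C≢Y =
      polymorphism A B C P

    twoSubset-twoRecolourable : TwoRecolourable f Y
    twoSubset-twoRecolourable A B C P = recolour-partition P (≡-dec _≟_ A Y) (≡-dec _≟_ B Y) (≡-dec _≟_ C Y)

mainTheorem6 : (n : ℕ) (f : Subset n → D3) → IsPolymorphism f →
    (X Y : Subset n) → TwoSet f X → BooleanSet f Y → X ⊆ Y →
    TwoRecolourable f Y
mainTheorem6 n f polymorphism X Y fX≡2 _ X⊆Y = twoSubset-twoRecolourable polymorphism fX≡2 X⊆Y
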